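{- Let $G$ be a connected $\alpha$-excellent graph of order at least $2$. Then $G$ has no critical vertex, and every independent set $I$ of $G$ can be matched into $V(G)\setminus I$.
   Context: All graphs are finite and simple. $\alpha(G)$ denotes the independence number; an $\alpha$-set is a maximum independent set; $G$ is $\alpha$-excellent if every vertex lies in some $\alpha$-set. A vertex $v$ is critical if $\alpha(G-v)\ne\alpha(G)$ (equivalently, every maximum independent set contains $v$). A set $I$ can be matched into $V(G)\setminus I$ if there is a matching of $G$ each of whose edges joins a vertex of $I$ to a vertex of $V(G)\setminus I$ and which covers every vertex of $I$. -}

module Defs where

open import Data.Nat using (ℕ; _≤_; _≥_)
open import Data.Fin using (Fin)
open import Data.Fin.Subset using (Subset; _∈_; _∉_; ∣_∣)
open import Data.Product using (Σ; _×_; ∃)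
open import Relation.Nullary using (¬_; Dec)
open import Relation.Binary.PropositionalEquality using (_≡_; _≢_)
open import Level using (0ℓ)

record Graph (n : ℕ) : Set₁ where
  field
    Adj     : Fin n → Fin n → Set
    adj?    : ∀ u v → Dec (Adj u v)
    sym     : ∀ {u v} → Adj u v → Adj v u
    irrefl  : ∀ {u} → ¬ Adj u u
open Graph public

module _ {n : ℕ} (G : Graph n) where

  data Walk : Fin n → Fin n → Set where
    here : ∀ {u} → Walk u u
    step : ∀ {u w v} → Adj G u w → Walk w v → Walk u v

  Connected : Set
  Connected = ∀ u v → Walk u v

  Independent : Subset n → Set
  Independent S = ∀ u v → u ∈ S → v ∈ S → ¬ Adj G u v

  IsAlphaSet : Subset n → Set
  IsAlphaSet S = Independent S × (∀ T → Independent T → ∣ T ∣ ≤ ∣ S ∣)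

  IsAlpha : ℕ → Set
  IsAlpha k = Σ (Subset n) (λ S → IsAlphaSet S × ∣ S ∣ ≡ k)

  -- α(G - v) = k : independent sets of G - v are the independent sets of G avoiding v
  IsAlphaMinus : Fin n → ℕ → Set
  IsAlphaMinus v k = Σ (Subset n) (λ S → Independent S × v ∉ S × ∣ S ∣ ≡ k
                       × (∀ T → Independent T → v ∉ T → ∣ T ∣ ≤ ∣ S ∣))

  AlphaExcellent : Set
  AlphaExcellent = ∀ v → Σ (Subset n) (λ S → IsAlphaSet S × v ∈ S)

  Critical : Fin n → Set
  Critical v = ∀ k k′ → IsAlpha k → IsAlphaMinus v k′ → k ≢ k′

  -- I can be matched into V(G) \ I: an injective assignment f on I with
  -- u f(u) an edge and f(u) ∉ I (the edges {u, f u} form a matching covering I).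
  MatchableInto : Subset n → Set
  MatchableInto I = Σ (Fin n → Fin n) λ f →
      (∀ u → u ∈ I → Adj G u (f u) × f u ∉ I)
    × (∀ u v → u ∈ I → v ∈ I → f u ≡ f v → u ≡ v)

-- A vertex v has a neighbour w, since G is connected with at least two vertices; an α-set
-- through w avoids v, so deleting v does not lower α.
--
-- For the matching it suffices, by Hall's theorem, that |N(J)| ≥ |J| for every independent J.
-- Induct on J: pick x ∈ J and an α-set S avoiding x. By induction N(J ∩ S) has at least
-- |J ∩ S| vertices, none in S. Since (S ─ N(J ─ S)) ∪ (J ─ S) is independent, maximality of S
-- gives |S ∩ N(J ─ S)| ≥ |J ─ S|. The two neighbourhoods are disjoint parts of N(J).
-- Finally N(I) lies outside I because I is independent.
{-# OPTIONS --safe #-}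
module Submission where

open import Defs
open import Data.Nat using (ℕ; zero; suc; _+_; _≤_; _<_; _≥_; _≤?_; z≤n; s≤s)
open import Data.Nat.Properties
  using (+-suc; +-comm; +-identityʳ; +-mono-≤; +-monoʳ-≤; +-cancelˡ-≤; +-cancelʳ-≤;
         ≤-trans; ≤-reflexive; m≤m+n; ≰⇒>; module ≤-Reasoning)
open import Data.Fin using (Fin; zero; suc)
open import Data.Fin.Properties using (any?)
open import Data.Fin.Subset
open import Data.Fin.Subset.Properties
  using (_∈?_; _⊂?_; nonempty?; anySubset?; Empty-unique; ∣⊥∣≡0; ∣⁅x⁆∣≡1; x∈⁅x⁆; x∈⁅y⁆⇒x≡y;
         p⊆q⇒∣p∣≤∣q∣; x∈p∩q⁺; x∈p∩q⁻; p∩q⊆p; x∈p∪q⁻; x∈p∪q⁺; x∈p∧x∉q⇒x∈p─q; p─q⊆p;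
         p∩q≢∅⇒p─q⊂p; x∈p⇒p-x⊂p)
open import Data.Fin.Subset.Induction using (⊂-wellFounded)
open import Data.Vec using ([]; _∷_; here; there)
open import Data.Product using (Σ; ∃; _×_; _,_; proj₁; proj₂)
open import Data.Sum using (inj₁; inj₂)
open import Function using (id; _∘_)
open import Induction.WellFounded using (Acc; acc)
open import Relation.Nullary using (¬_; yes; no; does; contradiction)
open import Relation.Nullary.Decidable using (_×-dec_)
open import Relation.Unary using (Pred; Decidable)
open import Relation.Binary.PropositionalEquality as ≡ using (_≡_; refl; cong; subst)

select : ∀ {n ℓ} {P : Pred (Fin n) ℓ} → Decidable P → Subset n
select {zero}  P? = []
select {suc n} P? = does (P? zero) ∷ select (P? ∘ suc)

∈-select⁺ : ∀ {n ℓ} {P : Pred (Fin n) ℓ} (P? : Decidable P) {x} → P x → x ∈ select P?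
∈-select⁺ P? {zero}  Px with P? zero
... | yes _   = here
... | no ¬Px  = contradiction Px ¬Px
∈-select⁺ P? {suc x} Px = there (∈-select⁺ (P? ∘ suc) Px)

∈-select⁻ : ∀ {n ℓ} {P : Pred (Fin n) ℓ} (P? : Decidable P) {x} → x ∈ select P? → P x
∈-select⁻ P? {zero}  x∈ with P? zero
∈-select⁻ P? {zero}  _  | yes Px = Px
∈-select⁻ P? {zero}  () | no _
∈-select⁻ P? {suc x} (there x∈) = ∈-select⁻ (P? ∘ suc) x∈

x∈p─q⁻ : ∀ {n} (p q : Subset n) {x} → x ∈ p ─ q → x ∈ p × x ∉ q
x∈p─q⁻ (inside  ∷ p) (outside ∷ q) here = here , λ ()
x∈p─q⁻ (inside  ∷ p) (inside  ∷ q) {zero} ()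
x∈p─q⁻ (outside ∷ p) (inside  ∷ q) {zero} ()
x∈p─q⁻ (outside ∷ p) (outside ∷ q) {zero} ()
x∈p─q⁻ (s ∷ p) (t ∷ q) (there x∈p─q) with x∈p─q⁻ p q x∈p─q
... | x∈p , x∉q = there x∈p , λ { (there x∈q) → x∉q x∈q }

∣p∩q∣+∣p─q∣≡∣p∣ : ∀ {n} (p q : Subset n) → ∣ p ∩ q ∣ + ∣ p ─ q ∣ ≡ ∣ p ∣
∣p∩q∣+∣p─q∣≡∣p∣ []            []            = refl
∣p∩q∣+∣p─q∣≡∣p∣ (inside  ∷ p) (inside  ∷ q) = cong suc (∣p∩q∣+∣p─q∣≡∣p∣ p q)
∣p∩q∣+∣p─q∣≡∣p∣ (inside  ∷ p) (outside ∷ q) =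
  ≡.trans (+-suc _ _) (cong suc (∣p∩q∣+∣p─q∣≡∣p∣ p q))
∣p∩q∣+∣p─q∣≡∣p∣ (outside ∷ p) (inside  ∷ q) = ∣p∩q∣+∣p─q∣≡∣p∣ p q
∣p∩q∣+∣p─q∣≡∣p∣ (outside ∷ p) (outside ∷ q) = ∣p∩q∣+∣p─q∣≡∣p∣ p q

∣p∪q∣+∣p∩q∣≡∣p∣+∣q∣ : ∀ {n} (p q : Subset n) → ∣ p ∪ q ∣ + ∣ p ∩ q ∣ ≡ ∣ p ∣ + ∣ q ∣
∣p∪q∣+∣p∩q∣≡∣p∣+∣q∣ []            []            = refl
∣p∪q∣+∣p∩q∣≡∣p∣+∣q∣ (inside  ∷ p) (inside  ∷ q) = cong suc (begin
  ∣ p ∪ q ∣ + suc ∣ p ∩ q ∣  ≡⟨ +-suc _ _ ⟩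
  suc (∣ p ∪ q ∣ + ∣ p ∩ q ∣) ≡⟨ cong suc (∣p∪q∣+∣p∩q∣≡∣p∣+∣q∣ p q) ⟩
  suc (∣ p ∣ + ∣ q ∣)        ≡⟨ ≡.sym (+-suc _ _) ⟩
  ∣ p ∣ + suc ∣ q ∣          ∎)
  where open ≡.≡-Reasoning
∣p∪q∣+∣p∩q∣≡∣p∣+∣q∣ (inside  ∷ p) (outside ∷ q) = cong suc (∣p∪q∣+∣p∩q∣≡∣p∣+∣q∣ p q)
∣p∪q∣+∣p∩q∣≡∣p∣+∣q∣ (outside ∷ p) (inside  ∷ q) =
  ≡.trans (cong suc (∣p∪q∣+∣p∩q∣≡∣p∣+∣q∣ p q)) (≡.sym (+-suc _ _))
∣p∪q∣+∣p∩q∣≡∣p∣+∣q∣ (outside ∷ p) (outside ∷ q) = ∣p∪q∣+∣p∩q∣≡∣p∣+∣q∣ p q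

∣p∪q∣≤∣p∣+∣q∣ : ∀ {n} (p q : Subset n) → ∣ p ∪ q ∣ ≤ ∣ p ∣ + ∣ q ∣
∣p∪q∣≤∣p∣+∣q∣ p q = ≤-trans (m≤m+n _ _) (≤-reflexive (∣p∪q∣+∣p∩q∣≡∣p∣+∣q∣ p q))

Empty⇒∣p∣≡0 : ∀ {n} {p : Subset n} → Empty p → ∣ p ∣ ≡ 0
Empty⇒∣p∣≡0 {n} p-empty = ≡.trans (cong ∣_∣ (Empty-unique p-empty)) (∣⊥∣≡0 n)

∣p∪q∣≡∣p∣+∣q∣ : ∀ {n} {p q : Subset n} → Empty (p ∩ q) → ∣ p ∪ q ∣ ≡ ∣ p ∣ + ∣ q ∣
∣p∪q∣≡∣p∣+∣q∣ {p = p} {q} disjoint = begin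
  ∣ p ∪ q ∣             ≡⟨ ≡.sym (+-identityʳ _) ⟩
  ∣ p ∪ q ∣ + 0         ≡⟨ cong (∣ p ∪ q ∣ +_) (≡.sym (Empty⇒∣p∣≡0 disjoint)) ⟩
  ∣ p ∪ q ∣ + ∣ p ∩ q ∣ ≡⟨ ∣p∪q∣+∣p∩q∣≡∣p∣+∣q∣ p q ⟩
  ∣ p ∣ + ∣ q ∣         ∎
  where open ≡.≡-Reasoning

∣p∣>0⇒Nonempty : ∀ {n} {p : Subset n} → 0 < ∣ p ∣ → Nonempty p
∣p∣>0⇒Nonempty {p = p} ∣p∣>0 with nonempty? p
... | yes p-nonempty = p-nonempty
... | no  p-empty    with Empty⇒∣p∣≡0 p-empty
... | ∣p∣≡0 = contradiction (subst (0 <_) ∣p∣≡0 ∣p∣>0) λ ()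

module _ {n : ℕ} where

  image : (Fin n → Subset n) → Subset n → Subset n
  image E J = select (λ v → any? (λ u → u ∈? J ×-dec v ∈? E u))

  ∈-image⁺ : ∀ E {J u v} → u ∈ J → v ∈ E u → v ∈ image E J
  ∈-image⁺ E u∈J v∈Eu = ∈-select⁺ _ (_ , u∈J , v∈Eu)

  ∈-image⁻ : ∀ E {J v} → v ∈ image E J → ∃ λ u → u ∈ J × v ∈ E u
  ∈-image⁻ E = ∈-select⁻ _

  image-mono : ∀ E {J K} → J ⊆ K → image E J ⊆ image E K
  image-mono E J⊆K v∈EJ with ∈-image⁻ E v∈EJ
  ... | _ , u∈J , v∈Eu = ∈-image⁺ E (J⊆K u∈J) v∈Eu

  _─ᶠ_ : (Fin n → Subset n) → Subset n → Fin n → Subset n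
  (E ─ᶠ X) u = E u ─ X

  HallCondition : (Fin n → Subset n) → Subset n → Set
  HallCondition E I = ∀ {J} → J ⊆ I → ∣ J ∣ ≤ ∣ image E J ∣

  -- E is indexed by Fin n itself, not Fin m, so that even for I empty a total f exists (id).
  Matching : (Fin n → Subset n) → Subset n → Set
  Matching E I = Σ (Fin n → Fin n) λ f →
    (∀ {u} → u ∈ I → f u ∈ E u) × (∀ {u v} → u ∈ I → v ∈ I → f u ≡ f v → u ≡ v)

  matching-⁅⁆ : ∀ {E u₀ w} → w ∈ E u₀ → Matching E ⁅ u₀ ⁆
  matching-⁅⁆ {E} {u₀} {w} w∈Eu₀ = (λ _ → w) , w∈E , λ u∈ v∈ _ → ≡.trans (at u∈) (≡.sym (at v∈))
    where
    at : ∀ {u} → u ∈ ⁅ u₀ ⁆ → u ≡ u₀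
    at = x∈⁅y⁆⇒x≡y u₀
    w∈E : ∀ {u} → u ∈ ⁅ u₀ ⁆ → w ∈ E u
    w∈E u∈ = subst (λ u → w ∈ E u) (≡.sym (at u∈)) w∈Eu₀

  glue : ∀ {E I J X} → J ⊆ I → (g : Matching E J) → (∀ {u} → u ∈ J → proj₁ g u ∈ X)
       → Matching (E ─ᶠ X) (I ─ J) → Matching E I
  glue {E} {I} {J} {X} J⊆I (g , g∈E , g-inj) g∈X (h , h∈E─X , h-inj) = f , f∈E , f-inj
    where
    f : Fin n → Fin n
    f u with u ∈? J
    ... | yes _ = g u
    ... | no  _ = h u

    h∉X : ∀ {u} → u ∈ I → u ∉ J → h u ∉ X
    h∉X u∈I u∉J = proj₂ (x∈p─q⁻ _ X (h∈E─X (x∈p∧x∉q⇒x∈p─q u∈I u∉J)))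

    f∈E : ∀ {u} → u ∈ I → f u ∈ E u
    f∈E {u} u∈I with u ∈? J
    ... | yes u∈J = g∈E u∈J
    ... | no  u∉J = proj₁ (x∈p─q⁻ _ X (h∈E─X (x∈p∧x∉q⇒x∈p─q u∈I u∉J)))

    f-inj : ∀ {u v} → u ∈ I → v ∈ I → f u ≡ f v → u ≡ v
    f-inj {u} {v} u∈I v∈I with u ∈? J | v ∈? J
    ... | yes u∈J | yes v∈J = g-inj u∈J v∈J
    ... | no  u∉J | no  v∉J = h-inj (x∈p∧x∉q⇒x∈p─q u∈I u∉J) (x∈p∧x∉q⇒x∈p─q v∈I v∉J)
    ... | yes u∈J | no  v∉J = λ gu≡hv → contradiction (subst (_∈ X) gu≡hv (g∈X u∈J)) (h∉X v∈I v∉J)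
    ... | no  u∉J | yes v∈J = λ hu≡gv → contradiction (subst (_∈ X) (≡.sym hu≡gv) (g∈X v∈J)) (h∉X u∈I u∉J)

  hallCondition-─-tight : ∀ {E I J} → J ⊆ I → ∣ image E J ∣ ≤ ∣ J ∣ → HallCondition E I
                        → HallCondition (E ─ᶠ image E J) (I ─ J)
  hallCondition-─-tight {E} {I} {J} J⊆I tight hall-EI {K} K⊆I─J =
    +-cancelʳ-≤ ∣ J ∣ _ _ (begin
      ∣ K ∣ + ∣ J ∣                ≡⟨ ≡.sym (∣p∪q∣≡∣p∣+∣q∣ K∩J-empty) ⟩
      ∣ K ∪ J ∣                    ≤⟨ hall-EI K∪J⊆I ⟩
      ∣ image E (K ∪ J) ∣          ≤⟨ p⊆q⇒∣p∣≤∣q∣ covered ⟩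
      ∣ image (E ─ᶠ X) K ∪ X ∣     ≤⟨ ∣p∪q∣≤∣p∣+∣q∣ (image (E ─ᶠ X) K) X ⟩
      ∣ image (E ─ᶠ X) K ∣ + ∣ X ∣ ≤⟨ +-monoʳ-≤ ∣ image (E ─ᶠ X) K ∣ tight ⟩
      ∣ image (E ─ᶠ X) K ∣ + ∣ J ∣ ∎)
    where
    open ≤-Reasoning
    X = image E J

    K∩J-empty : Empty (K ∩ J)
    K∩J-empty (u , u∈K∩J) with x∈p∩q⁻ K J u∈K∩J
    ... | u∈K , u∈J = proj₂ (x∈p─q⁻ I J (K⊆I─J u∈K)) u∈J

    K∪J⊆I : K ∪ J ⊆ I
    K∪J⊆I u∈K∪J with x∈p∪q⁻ K J u∈K∪J
    ... | inj₁ u∈K = p─q⊆p I J (K⊆I─J u∈K)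
    ... | inj₂ u∈J = J⊆I u∈J

    covered : image E (K ∪ J) ⊆ image (E ─ᶠ X) K ∪ X
    covered {v} v∈ with ∈-image⁻ E v∈ | v ∈? X
    ... | _ , _ , _ | yes v∈X = x∈p∪q⁺ (inj₂ v∈X)
    ... | u , u∈K∪J , v∈Eu | no v∉X with x∈p∪q⁻ K J u∈K∪J
    ... | inj₁ u∈K = x∈p∪q⁺ (inj₁ (∈-image⁺ (E ─ᶠ X) u∈K (x∈p∧x∉q⇒x∈p─q v∈Eu v∉X)))
    ... | inj₂ u∈J = contradiction (∈-image⁺ E u∈J v∈Eu) v∉X

  hallCondition-─-⁅⁆ : ∀ {E I u₀} w → u₀ ∈ I
                     → (∀ {K} → Nonempty K → K ⊂ I → ∣ K ∣ < ∣ image E K ∣)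
                     → HallCondition (E ─ᶠ ⁅ w ⁆) (I - u₀)
  hallCondition-─-⁅⁆ {E} {I} {u₀} w u₀∈I surplus {K} K⊆I-u₀ with nonempty? K
  ... | no  K-empty = subst (_≤ ∣ image (E ─ᶠ ⁅ w ⁆) K ∣) (≡.sym (Empty⇒∣p∣≡0 K-empty)) z≤n
  ... | yes K-nonempty = +-cancelʳ-≤ 1 _ _ (begin
      ∣ K ∣ + 1                             ≡⟨ +-comm _ 1 ⟩
      suc ∣ K ∣                             ≤⟨ surplus K-nonempty K⊂I ⟩
      ∣ image E K ∣                         ≤⟨ p⊆q⇒∣p∣≤∣q∣ covered ⟩
      ∣ image (E ─ᶠ ⁅ w ⁆) K ∪ ⁅ w ⁆ ∣      ≤⟨ ∣p∪q∣≤∣p∣+∣q∣ (image (E ─ᶠ ⁅ w ⁆) K) ⁅ w ⁆ ⟩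
      ∣ image (E ─ᶠ ⁅ w ⁆) K ∣ + ∣ ⁅ w ⁆ ∣  ≡⟨ cong (∣ image (E ─ᶠ ⁅ w ⁆) K ∣ +_) (∣⁅x⁆∣≡1 w) ⟩
      ∣ image (E ─ᶠ ⁅ w ⁆) K ∣ + 1          ∎)
    where
    open ≤-Reasoning

    K⊂I : K ⊂ I
    K⊂I = p─q⊆p I ⁅ u₀ ⁆ ∘ K⊆I-u₀
        , u₀ , u₀∈I , λ u₀∈K → proj₂ (x∈p─q⁻ I ⁅ u₀ ⁆ (K⊆I-u₀ u₀∈K)) (x∈⁅x⁆ u₀)

    covered : image E K ⊆ image (E ─ᶠ ⁅ w ⁆) K ∪ ⁅ w ⁆
    covered {v} v∈ with ∈-image⁻ E v∈ | v ∈? ⁅ w ⁆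
    ... | _ , _ , _     | yes v∈w = x∈p∪q⁺ (inj₂ v∈w)
    ... | u , u∈K , v∈Eu | no v∉w = x∈p∪q⁺ (inj₁ (∈-image⁺ (E ─ᶠ ⁅ w ⁆) u∈K (x∈p∧x∉q⇒x∈p─q v∈Eu v∉w)))

  Tight : (Fin n → Subset n) → Subset n → Subset n → Set
  Tight E I J = Nonempty J × J ⊂ I × ∣ image E J ∣ ≤ ∣ J ∣

  tight? : ∀ E I → Decidable (Tight E I)
  tight? E I J = nonempty? J ×-dec J ⊂? I ×-dec ∣ image E J ∣ ≤? ∣ J ∣

  -- Halmos–Vaughan: if some nonempty J ⊂ I is tight, match J and I ─ J separately (the latter
  -- avoiding the image of J); otherwise every such J has surplus, so any edge at u₀ may be used.
  hall-acc : ∀ {E I} → Acc _⊂_ I → HallCondition E I → Matching E I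
  hall-acc {E} {I} (acc smaller) hall-EI with nonempty? I
  ... | no I-empty =
    id , (λ u∈I → contradiction (_ , u∈I) I-empty) , (λ u∈I → contradiction (_ , u∈I) I-empty)
  ... | yes (u₀ , u₀∈I) with anySubset? (tight? E I)
  ... | yes (J , (x , x∈J) , J⊂I@(J⊆I , _) , tight) =
    glue J⊆I g (λ u∈J → ∈-image⁺ E u∈J (proj₁ (proj₂ g) u∈J))
         (hall-acc (smaller I─J⊂I) (hallCondition-─-tight J⊆I tight hall-EI))
    where
    g : Matching E J
    g = hall-acc (smaller J⊂I) (λ K⊆J → hall-EI (J⊆I ∘ K⊆J))
    I─J⊂I : I ─ J ⊂ I
    I─J⊂I = p∩q≢∅⇒p─q⊂p I J (x , x∈p∩q⁺ (J⊆I x∈J , x∈J))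
  ... | no no-tight =
    glue ⁅u₀⁆⊆I (matching-⁅⁆ w∈Eu₀) (λ _ → x∈⁅x⁆ w)
         (hall-acc (smaller (x∈p⇒p-x⊂p u₀∈I)) (hallCondition-─-⁅⁆ w u₀∈I surplus))
    where
    ⁅u₀⁆⊆I : ⁅ u₀ ⁆ ⊆ I
    ⁅u₀⁆⊆I u∈⁅u₀⁆ = subst (_∈ I) (≡.sym (x∈⁅y⁆⇒x≡y u₀ u∈⁅u₀⁆)) u₀∈I
    representative : ∃ λ w → w ∈ E u₀
    representative with ∣p∣>0⇒Nonempty (≤-trans (≤-reflexive (≡.sym (∣⁅x⁆∣≡1 u₀))) (hall-EI ⁅u₀⁆⊆I))
    ... | w , w∈ with ∈-image⁻ E w∈
    ... | u , u∈⁅u₀⁆ , w∈Eu = w , subst (λ u → w ∈ E u) (x∈⁅y⁆⇒x≡y u₀ u∈⁅u₀⁆) w∈Eu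
    w : Fin n
    w = proj₁ representative
    w∈Eu₀ : w ∈ E u₀
    w∈Eu₀ = proj₂ representative
    surplus : ∀ {K} → Nonempty K → K ⊂ I → ∣ K ∣ < ∣ image E K ∣
    surplus K-nonempty K⊂I = ≰⇒> λ K-tight → no-tight (_ , K-nonempty , K⊂I , K-tight)

  hall : ∀ {E I} → HallCondition E I → Matching E I
  hall = hall-acc (⊂-wellFounded _)

module _ {n : ℕ} (G : Graph n) where

  neighbours : Fin n → Subset n
  neighbours u = select (adj? G u)

  neighbourhood : Subset n → Subset n
  neighbourhood = image neighbours

  ∈-neighbourhood⁺ : ∀ {J u v} → u ∈ J → Adj G u v → v ∈ neighbourhood J
  ∈-neighbourhood⁺ u∈J uv = ∈-image⁺ neighbours u∈J (∈-select⁺ (adj? G _) uv)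

  ∈-neighbourhood⁻ : ∀ {J v} → v ∈ neighbourhood J → ∃ λ u → u ∈ J × Adj G u v
  ∈-neighbourhood⁻ v∈NJ with ∈-image⁻ neighbours v∈NJ
  ... | u , u∈J , v∈Nu = u , u∈J , ∈-select⁻ (adj? G u) v∈Nu

  independent-⊆ : ∀ {I J} → J ⊆ I → Independent G I → Independent G J
  independent-⊆ J⊆I indI u v u∈J v∈J = indI u v (J⊆I u∈J) (J⊆I v∈J)

  independent-exchange : ∀ {S B} → Independent G S → Independent G B
                       → Independent G ((S ─ neighbourhood B) ∪ B)
  independent-exchange {S} {B} indS indB u v u∈ v∈
    with x∈p∪q⁻ (S ─ neighbourhood B) B u∈ | x∈p∪q⁻ (S ─ neighbourhood B) B v∈
  ... | inj₁ u∈S─NB | inj₁ v∈S─NB =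
    indS u v (proj₁ (x∈p─q⁻ S _ u∈S─NB)) (proj₁ (x∈p─q⁻ S _ v∈S─NB))
  ... | inj₂ u∈B | inj₂ v∈B = indB u v u∈B v∈B
  ... | inj₁ u∈S─NB | inj₂ v∈B =
    λ uv → proj₂ (x∈p─q⁻ S _ u∈S─NB) (∈-neighbourhood⁺ v∈B (sym G uv))
  ... | inj₂ u∈B | inj₁ v∈S─NB =
    λ uv → proj₂ (x∈p─q⁻ S _ v∈S─NB) (∈-neighbourhood⁺ u∈B uv)

  ∣B∣≤∣S∩N[B]∣ : ∀ {S B} → IsAlphaSet G S → Independent G B → (∀ {x} → x ∈ B → x ∉ S)
               → ∣ B ∣ ≤ ∣ S ∩ neighbourhood B ∣
  ∣B∣≤∣S∩N[B]∣ {S} {B} (indS , maximum) indB B-avoids-S =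
    +-cancelˡ-≤ ∣ S ─ neighbourhood B ∣ _ _ (begin
      ∣ S ─ neighbourhood B ∣ + ∣ B ∣                   ≡⟨ ≡.sym (∣p∪q∣≡∣p∣+∣q∣ disjoint) ⟩
      ∣ (S ─ neighbourhood B) ∪ B ∣                     ≤⟨ maximum _ (independent-exchange indS indB) ⟩
      ∣ S ∣                                             ≡⟨ ≡.sym (∣p∩q∣+∣p─q∣≡∣p∣ S (neighbourhood B)) ⟩
      ∣ S ∩ neighbourhood B ∣ + ∣ S ─ neighbourhood B ∣ ≡⟨ +-comm ∣ S ∩ neighbourhood B ∣ _ ⟩
      ∣ S ─ neighbourhood B ∣ + ∣ S ∩ neighbourhood B ∣ ∎)
    where
    open ≤-Reasoning
    disjoint : Empty ((S ─ neighbourhood B) ∩ B)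
    disjoint (x , x∈) with x∈p∩q⁻ (S ─ neighbourhood B) B x∈
    ... | x∈S─NB , x∈B = B-avoids-S x∈B (proj₁ (x∈p─q⁻ S _ x∈S─NB))

  connected⇒neighbour : n ≥ 2 → Connected G → ∀ u → ∃ (Adj G u)
  connected⇒neighbour (s≤s (s≤s z≤n)) connected zero with connected zero (suc zero)
  ... | step uw _ = _ , uw
  connected⇒neighbour (s≤s (s≤s z≤n)) connected (suc u) with connected (suc u) zero
  ... | step uw _ = _ , uw

  module _ (neighbour : ∀ u → ∃ (Adj G u)) (excellent : AlphaExcellent G) where

    alphaSet-avoiding : ∀ x → Σ (Subset n) λ S → IsAlphaSet G S × x ∉ S
    alphaSet-avoiding x with neighbour x
    ... | w , xw with excellent w
    ... | S , αS@(indS , _) , w∈S = S , αS , λ x∈S → indS w x w∈S x∈S (sym G xw)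

    no-critical : ∀ v → ¬ Critical G v
    no-critical v critical with alphaSet-avoiding v
    ... | S , αS@(indS , maximum) , v∉S =
      critical ∣ S ∣ ∣ S ∣ (S , αS , refl) (S , indS , v∉S , refl , λ T indT _ → maximum T indT) refl

    independent-expands-acc : ∀ {J} → Acc _⊂_ J → Independent G J → ∣ J ∣ ≤ ∣ neighbourhood J ∣
    independent-expands-acc {J} (acc smaller) indJ with nonempty? J
    ... | no J-empty = subst (_≤ ∣ neighbourhood J ∣) (≡.sym (Empty⇒∣p∣≡0 J-empty)) z≤n
    ... | yes (x , x∈J) with alphaSet-avoiding x
    ... | S , αS@(indS , _) , x∉S = begin
      ∣ J ∣                                                     ≡⟨ ≡.sym (∣p∩q∣+∣p─q∣≡∣p∣ J S) ⟩
      ∣ J ∩ S ∣ + ∣ J ─ S ∣                                     ≤⟨ +-mono-≤ J∩S-expands J─S-expands-into-S ⟩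
      ∣ neighbourhood (J ∩ S) ∣ + ∣ S ∩ neighbourhood (J ─ S) ∣ ≡⟨ ≡.sym (∣p∪q∣≡∣p∣+∣q∣ disjoint) ⟩
      ∣ neighbourhood (J ∩ S) ∪ S ∩ neighbourhood (J ─ S) ∣     ≤⟨ p⊆q⇒∣p∣≤∣q∣ ⊆N[J] ⟩
      ∣ neighbourhood J ∣                                       ∎
      where
      open ≤-Reasoning
      J∩S⊂J : J ∩ S ⊂ J
      J∩S⊂J = p∩q⊆p J S , x , x∈J , λ x∈J∩S → x∉S (proj₂ (x∈p∩q⁻ J S x∈J∩S))
      J∩S-expands : ∣ J ∩ S ∣ ≤ ∣ neighbourhood (J ∩ S) ∣
      J∩S-expands = independent-expands-acc (smaller J∩S⊂J) (independent-⊆ (p∩q⊆p J S) indJ)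
      J─S-expands-into-S : ∣ J ─ S ∣ ≤ ∣ S ∩ neighbourhood (J ─ S) ∣
      J─S-expands-into-S = ∣B∣≤∣S∩N[B]∣ αS (independent-⊆ (p─q⊆p J S) indJ) (proj₂ ∘ x∈p─q⁻ J S)
      disjoint : Empty (neighbourhood (J ∩ S) ∩ (S ∩ neighbourhood (J ─ S)))
      disjoint (v , v∈) with x∈p∩q⁻ (neighbourhood (J ∩ S)) _ v∈
      ... | v∈N[J∩S] , v∈S∩N[J─S] with ∈-neighbourhood⁻ v∈N[J∩S]
      ... | u , u∈J∩S , uv = indS u v (proj₂ (x∈p∩q⁻ J S u∈J∩S)) (proj₁ (x∈p∩q⁻ S _ v∈S∩N[J─S])) uv
      ⊆N[J] : neighbourhood (J ∩ S) ∪ S ∩ neighbourhood (J ─ S) ⊆ neighbourhood J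
      ⊆N[J] v∈ with x∈p∪q⁻ (neighbourhood (J ∩ S)) _ v∈
      ... | inj₁ v∈N[J∩S]   = image-mono neighbours (p∩q⊆p J S) v∈N[J∩S]
      ... | inj₂ v∈S∩N[J─S] = image-mono neighbours (p─q⊆p J S) (proj₂ (x∈p∩q⁻ S _ v∈S∩N[J─S]))

    independent-expands : ∀ {J} → Independent G J → ∣ J ∣ ≤ ∣ neighbourhood J ∣
    independent-expands = independent-expands-acc (⊂-wellFounded _)

    independent-matchable : ∀ {I} → Independent G I → MatchableInto G I
    independent-matchable {I} indI with hall (λ J⊆I → independent-expands (independent-⊆ J⊆I indI))
    ... | f , f∈N , f-inj = f , (λ u u∈I → adj u∈I , λ fu∈I → indI u (f u) u∈I fu∈I (adj u∈I)) , λ _ _ → f-inj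
      where
      adj : ∀ {u} → u ∈ I → Adj G u (f u)
      adj {u} u∈I = ∈-select⁻ (adj? G u) (f∈N u∈I)

proposition2p4 : ∀ {n : ℕ} (G : Graph n) → n ≥ 2 → Connected G → AlphaExcellent G
                 → (∀ v → ¬ Critical G v)
                   × (∀ (I : Subset n) → Independent G I → MatchableInto G I)
proposition2p4 G n≥2 connected excellent =
  no-critical G neighbour excellent , λ _ → independent-matchable G neighbour excellent
  where
  neighbour : ∀ u → ∃ (Adj G u)
  neighbour = connected⇒neighbour G n≥2 connected
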